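{- Let $k\ge 1$ be an integer and let $G$ be a threshold graph whose creation sequence $\mathrm{seq}(G)$ contains at least $k$ ones. Then a vertex $v\in V(G)$ belongs to the $k$-core of $G$ if and only if $\deg_G(v)\ge k$.
   Context: The $k$-core of a graph $G$ is the maximum induced subgraph of $G$ in which every vertex has degree at least $k$ (obtained by iteratively deleting vertices of degree less than $k$). A threshold graph on $n$ vertices is built from a single base vertex by adding $n-1$ vertices one at a time, each either isolated or dominating (adjacent to all existing vertices); its creation sequence $\mathrm{seq}(G)\in\{0,1\}^{n-1}$ records $1$ for a dominating and $0$ for an isolated addition. -}

module Defs where

open import Data.Bool using (Bool; true; false; if_then_else_; _∧_)
open import Data.Nat using (ℕ; zero; suc; _≤ᵇ_)
open import Data.Fin using (Fin; zero; suc; _<?_; _≟_)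
open import Data.Fin.Subset using (Subset; _∩_; ∣_∣; ⊤)
open import Data.Vec using (Vec; lookup; tabulate; []; _∷_)
open import Relation.Nullary.Decidable using (does)

-- A threshold graph on n = suc m vertices is given by its creation sequence
-- seq ∈ {0,1}^m, here a Vec Bool m (true = dominating, false = isolated).
-- Vertex 0 is the base vertex; vertex (suc i) is the (i+1)-th added vertex,
-- whose type is  lookup seq i .

ones : ∀ {m} → Vec Bool m → ℕ
ones [] = zero
ones (true ∷ s) = suc (ones s)
ones (false ∷ s) = ones s

dominating : ∀ {m} → Vec Bool m → Fin (suc m) → Bool
dominating s zero = false
dominating s (suc i) = lookup s i

adj : ∀ {m} → Vec Bool m → Fin (suc m) → Fin (suc m) → Bool
adj s u v =
  if does (u ≟ v) then false
  else (if does (u <? v) then dominating s v else dominating s u)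

nbhd : ∀ {m} → Vec Bool m → Fin (suc m) → Subset (suc m)
nbhd s v = tabulate (λ u → adj s v u)

degIn : ∀ {m} → Vec Bool m → Subset (suc m) → Fin (suc m) → ℕ
degIn s S v = ∣ S ∩ nbhd s v ∣

deg : ∀ {m} → Vec Bool m → Fin (suc m) → ℕ
deg s v = degIn s ⊤ v

peel : ∀ {m} → Vec Bool m → ℕ → Subset (suc m) → Subset (suc m)
peel s k S = S ∩ tabulate (λ v → k ≤ᵇ degIn s S v)

iterate : ∀ {A : Set} → ℕ → (A → A) → A → A
iterate zero f a = a
iterate (suc n) f a = f (iterate n f a)

-- vertex set of the k-core: iterate peeling from V(G); each round either
-- removes a vertex or reaches a fixed point, so suc m rounds suffice.
kCore : ∀ {m} → Vec Bool m → ℕ → Subset (suc m)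
kCore {m} s k = iterate (suc m) (peel s k) ⊤

-- The base vertex together with the dominating vertices forms a clique C of
-- size ones s + 1, and every edge has an endpoint in C (its later endpoint is
-- dominating).  Hence a vertex of C has at least ones s ≥ k neighbours inside
-- C, and a vertex outside C has all its neighbours in C.  So every vertex of
-- degree at least k keeps k neighbours inside C, and the set of such vertices
-- has minimum degree k; such a set survives every peeling round.
module Submission where

open import Defs
open import Data.Nat using (ℕ; suc; _≤_; _≤ᵇ_; s≤s; s≤s⁻¹)
open import Data.Nat.Properties using (≤-reflexive; ≤-trans; n≤1+n; ≤⇒≤ᵇ; ≤ᵇ⇒≤; module ≤-Reasoning)
open import Data.Bool using (Bool; true; false)
open import Data.Bool.Properties using (T-≡)
open import Data.Fin using (Fin; zero; suc; _<?_; _≟_) renaming (_<_ to _<ᶠ_)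
open import Data.Fin.Properties using (<-cmp; <-asym; <⇒≢)
open import Data.Fin.Subset using (Subset; _∈_; _∉_; _∩_; _─_; _-_; _⊆_; ∣_∣; ⊤; inside; outside)
open import Data.Fin.Subset.Properties
  using (_∈?_; ∈⊤; ⊆⊤; drop-there; x∈⁅x⁆; p─⊥≡p; p─q⊆p; x∈p∩q⁺; x∈p∩q⁻; p⊆q⇒∣p∣≤∣q∣)
open import Data.Vec using (Vec; tabulate; []; _∷_; here; there)
open import Data.Vec.Properties using (lookup∘tabulate; []=⇒lookup; lookup⇒[]=)
open import Data.Product using (_×_; _,_; proj₂)
open import Data.Sum using (_⊎_; inj₁; inj₂)
open import Function using (_∘_)
open import Function.Bundles using (Equivalence)
open import Relation.Binary using (tri<; tri≈; tri>)
open import Relation.Binary.PropositionalEquality using (_≡_; _≢_; refl; sym; trans; cong)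
open import Relation.Nullary using (yes; no; contradiction)
open import Relation.Nullary.Decidable using (dec-true; dec-false)

private
  variable
    m n k : ℕ

∈-tabulate⁺ : (f : Fin n → Bool) {x : Fin n} → f x ≡ true → x ∈ tabulate f
∈-tabulate⁺ f {x} fx = lookup⇒[]= x (tabulate f) (trans (lookup∘tabulate f x) fx)

∈-tabulate⁻ : (f : Fin n → Bool) {x : Fin n} → x ∈ tabulate f → f x ≡ true
∈-tabulate⁻ f {x} x∈ = trans (sym (lookup∘tabulate f x)) ([]=⇒lookup x∈)

∈-tabulate-≤ᵇ⁺ : (f : Fin n → ℕ) {x : Fin n} → k ≤ f x → x ∈ tabulate (λ y → k ≤ᵇ f y)
∈-tabulate-≤ᵇ⁺ f k≤fx = ∈-tabulate⁺ _ (Equivalence.to T-≡ (≤⇒≤ᵇ k≤fx))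

∈-tabulate-≤ᵇ⁻ : (f : Fin n → ℕ) {x : Fin n} → x ∈ tabulate (λ y → k ≤ᵇ f y) → k ≤ f x
∈-tabulate-≤ᵇ⁻ {k = k} f {x} x∈ = ≤ᵇ⇒≤ k (f x) (Equivalence.from T-≡ (∈-tabulate⁻ _ x∈))

∩-monoˡ : {p q : Subset n} (r : Subset n) → p ⊆ q → p ∩ r ⊆ q ∩ r
∩-monoˡ {p = p} r p⊆q x∈p∩r with x∈p∩q⁻ p r x∈p∩r
... | x∈p , x∈r = x∈p∩q⁺ (p⊆q x∈p , x∈r)

x∈p─q⇒x∉q : (p q : Subset n) {x : Fin n} → x ∈ p ─ q → x ∉ q
x∈p─q⇒x∉q (inside ∷ p) (outside ∷ q) here ()
x∈p─q⇒x∉q (_ ∷ p) (_ ∷ q) (there x∈p─q) (there x∈q) = x∈p─q⇒x∉q p q x∈p─q x∈q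

∣p∣≤1+∣p-x∣ : (p : Subset n) (x : Fin n) → ∣ p ∣ ≤ suc ∣ p - x ∣
∣p∣≤1+∣p-x∣ (inside ∷ p) zero = s≤s (≤-reflexive (sym (cong ∣_∣ (p─⊥≡p p))))
∣p∣≤1+∣p-x∣ (outside ∷ p) zero = ≤-trans (≤-reflexive (sym (cong ∣_∣ (p─⊥≡p p)))) (n≤1+n _)
∣p∣≤1+∣p-x∣ (inside ∷ p) (suc x) = s≤s (∣p∣≤1+∣p-x∣ p x)
∣p∣≤1+∣p-x∣ (outside ∷ p) (suc x) = ∣p∣≤1+∣p-x∣ p x

∣s∣≡ones : (s : Vec Bool m) → ∣ s ∣ ≡ ones s
∣s∣≡ones [] = refl
∣s∣≡ones (true ∷ s) = cong suc (∣s∣≡ones s)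
∣s∣≡ones (false ∷ s) = ∣s∣≡ones s

module _ (s : Vec Bool m) where

  clique : Subset (suc m)
  clique = inside ∷ s

  adj-≡ : {u v : Fin (suc m)} → u ≡ v → adj s u v ≡ false
  adj-≡ {u} {v} u≡v rewrite dec-true (u ≟ v) u≡v = refl

  adj-<ʳ : {u v : Fin (suc m)} → u <ᶠ v → adj s u v ≡ dominating s v
  adj-<ʳ {u} {v} u<v rewrite dec-false (u ≟ v) (<⇒≢ u<v) | dec-true (u <? v) u<v = refl

  adj->ˡ : {u v : Fin (suc m)} → v <ᶠ u → adj s u v ≡ dominating s u
  adj->ˡ {u} {v} v<u
    rewrite dec-false (u ≟ v) (<⇒≢ v<u ∘ sym) | dec-false (u <? v) (<-asym v<u) = refl

  dominating⇒∈clique : {v : Fin (suc m)} → dominating s v ≡ true → v ∈ clique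
  dominating⇒∈clique {suc i} dom = there (lookup⇒[]= i s dom)

  ∈clique⇒dominating : {u v : Fin (suc m)} → u <ᶠ v → v ∈ clique → dominating s v ≡ true
  ∈clique⇒dominating {v = suc j} _ v∈C = []=⇒lookup (drop-there v∈C)

  adj-clique : {u v : Fin (suc m)} → u ∈ clique → v ∈ clique → u ≢ v → adj s u v ≡ true
  adj-clique {u} {v} u∈C v∈C u≢v with <-cmp u v
  ... | tri< u<v _ _ = trans (adj-<ʳ u<v) (∈clique⇒dominating u<v v∈C)
  ... | tri≈ _ u≡v _ = contradiction u≡v u≢v
  ... | tri> _ _ v<u = trans (adj->ˡ v<u) (∈clique⇒dominating v<u u∈C)

  adj⇒∈clique : {u v : Fin (suc m)} → adj s u v ≡ true → u ∈ clique ⊎ v ∈ clique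
  adj⇒∈clique {u} {v} uv with <-cmp u v
  ... | tri< u<v _ _ = inj₂ (dominating⇒∈clique (trans (sym (adj-<ʳ u<v)) uv))
  ... | tri≈ _ u≡v _ = contradiction (trans (sym uv) (adj-≡ u≡v)) λ ()
  ... | tri> _ _ v<u = inj₁ (dominating⇒∈clique (trans (sym (adj->ˡ v<u)) uv))

  clique-v⊆nbhd : {v : Fin (suc m)} → v ∈ clique → clique - v ⊆ nbhd s v
  clique-v⊆nbhd {v} v∈C {u} u∈C-v = ∈-tabulate⁺ (adj s v) (adj-clique v∈C u∈C v≢u)
    where
    u∈C : u ∈ clique
    u∈C = p─q⊆p clique _ u∈C-v
    v≢u : v ≢ u
    v≢u refl = x∈p─q⇒x∉q clique _ u∈C-v (x∈⁅x⁆ v)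

  nbhd⊆clique : {v : Fin (suc m)} → v ∉ clique → nbhd s v ⊆ clique
  nbhd⊆clique {v} v∉C u∈N with adj⇒∈clique (∈-tabulate⁻ (adj s v) u∈N)
  ... | inj₁ v∈C = contradiction v∈C v∉C
  ... | inj₂ u∈C = u∈C

  degIn-mono : {A B : Subset (suc m)} (v : Fin (suc m)) → A ⊆ B → degIn s A v ≤ degIn s B v
  degIn-mono v A⊆B = p⊆q⇒∣p∣≤∣q∣ (∩-monoˡ (nbhd s v) A⊆B)

  degIn≤deg : (A : Subset (suc m)) (v : Fin (suc m)) → degIn s A v ≤ deg s v
  degIn≤deg A v = degIn-mono {A} {⊤} v ⊆⊤

  nbhd⊆⇒deg≤degIn : {A : Subset (suc m)} {v : Fin (suc m)} → nbhd s v ⊆ A → deg s v ≤ degIn s A v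
  nbhd⊆⇒deg≤degIn {A} {v} N⊆A = p⊆q⇒∣p∣≤∣q∣ λ u∈⊤∩N →
    let u∈N = proj₂ (x∈p∩q⁻ ⊤ (nbhd s v) u∈⊤∩N) in x∈p∩q⁺ (N⊆A u∈N , u∈N)

  ones≤degIn-clique : {v : Fin (suc m)} → v ∈ clique → ones s ≤ degIn s clique v
  ones≤degIn-clique {v} v∈C = s≤s⁻¹ (begin
    suc (ones s)              ≡⟨ cong suc (∣s∣≡ones s) ⟨
    ∣ clique ∣                ≤⟨ ∣p∣≤1+∣p-x∣ clique v ⟩
    suc ∣ clique - v ∣        ≤⟨ s≤s (p⊆q⇒∣p∣≤∣q∣ clique-v⊆clique∩nbhd) ⟩
    suc (degIn s clique v)    ∎)
    where
    open ≤-Reasoning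
    clique-v⊆clique∩nbhd : clique - v ⊆ clique ∩ nbhd s v
    clique-v⊆clique∩nbhd u∈ = x∈p∩q⁺ (p─q⊆p clique _ u∈ , clique-v⊆nbhd v∈C u∈)

  k≤degIn-clique : k ≤ ones s → (v : Fin (suc m)) → k ≤ deg s v → k ≤ degIn s clique v
  k≤degIn-clique k≤ones v k≤deg with v ∈? clique
  ... | yes v∈C = ≤-trans k≤ones (ones≤degIn-clique v∈C)
  ... | no v∉C = ≤-trans k≤deg (nbhd⊆⇒deg≤degIn {clique} {v} (nbhd⊆clique v∉C))

  ∈-peel⁺ : {S : Subset (suc m)} {v : Fin (suc m)} → v ∈ S → k ≤ degIn s S v → v ∈ peel s k S
  ∈-peel⁺ {S = S} v∈S k≤deg = x∈p∩q⁺ (v∈S , ∈-tabulate-≤ᵇ⁺ (degIn s S) k≤deg)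

  ∈-peel⁻ : {S : Subset (suc m)} {v : Fin (suc m)} → v ∈ peel s k S → v ∈ S × k ≤ degIn s S v
  ∈-peel⁻ {S = S} v∈ with x∈p∩q⁻ S _ v∈
  ... | v∈S , v∈T = v∈S , ∈-tabulate-≤ᵇ⁻ (degIn s S) v∈T

  MinDegree : ℕ → Subset (suc m) → Set
  MinDegree k S = {v : Fin (suc m)} → v ∈ S → k ≤ degIn s S v

  MinDegree⇒⊆iterate-peel : {S : Subset (suc m)} → MinDegree k S → (n : ℕ) → S ⊆ iterate n (peel s k) ⊤
  MinDegree⇒⊆iterate-peel minDeg 0 v∈S = ∈⊤
  MinDegree⇒⊆iterate-peel {k} {S} minDeg (suc n) {v} v∈S =
    ∈-peel⁺ {k} (S⊆ v∈S) (≤-trans (minDeg v∈S) (degIn-mono v S⊆))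
    where
    S⊆ : S ⊆ iterate n (peel s k) ⊤
    S⊆ = MinDegree⇒⊆iterate-peel minDeg n

  MinDegree⇒⊆kCore : {S : Subset (suc m)} → MinDegree k S → S ⊆ kCore s k
  MinDegree⇒⊆kCore minDeg = MinDegree⇒⊆iterate-peel minDeg (suc m)

  ∈kCore⇒k≤deg : {v : Fin (suc m)} → v ∈ kCore s k → k ≤ deg s v
  ∈kCore⇒k≤deg {k} {v} v∈K = ≤-trans (proj₂ (∈-peel⁻ {k} {S} v∈K)) (degIn≤deg S v)
    where
    S : Subset (suc m)
    S = iterate m (peel s k) ⊤

  highDegree : ℕ → Subset (suc m)
  highDegree k = tabulate (λ v → k ≤ᵇ deg s v)

  clique⊆highDegree : k ≤ ones s → clique ⊆ highDegree k
  clique⊆highDegree k≤ones {v} v∈C = ∈-tabulate-≤ᵇ⁺ (deg s)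
    (≤-trans k≤ones (≤-trans (ones≤degIn-clique v∈C) (degIn≤deg clique v)))

  highDegree-minDegree : k ≤ ones s → MinDegree k (highDegree k)
  highDegree-minDegree k≤ones {v} v∈H =
    ≤-trans (k≤degIn-clique k≤ones v (∈-tabulate-≤ᵇ⁻ (deg s) v∈H))
            (degIn-mono v (clique⊆highDegree k≤ones))

mainTheorem12 : (k : ℕ) → 1 ≤ k → (m : ℕ) → (s : Vec Bool m) → k ≤ ones s →
    (v : Fin (suc m)) → (v ∈ kCore s k → k ≤ deg s v) × (k ≤ deg s v → v ∈ kCore s k)
mainTheorem12 k _ m s k≤ones v =
  ∈kCore⇒k≤deg s ,
  λ k≤deg → MinDegree⇒⊆kCore s (highDegree-minDegree s k≤ones) (∈-tabulate-≤ᵇ⁺ (deg s) k≤deg)
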